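{- Let $G=Q_n(X)$ be a daisy cube and $ab\in E(G)$. If the notation of the endpoints can be chosen so that $|W_{ab}|>|W_{ba}|$, then $0^n\in W_{ab}$.
   Context: $B=\{0,1\}$; $Q_n$ has vertex set $B^n$ (binary strings of length $n$), two strings adjacent iff they differ in exactly one position; $0^n$ is the all-zero string. For $u,v\in B^n$ write $u\le v$ if $u_i\le v_i$ for all $i$. For $X\subseteq B^n$ the daisy cube $Q_n(X)$ is the subgraph of $Q_n$ induced by $\{u: u\le x\text{ for some }x\in X\}$, with vertices labelled by these binary strings. For an edge $ab$ (distances in $G$): $W_{ab}=\{w\in V(G): d(a,w)<d(b,w)\}$, $W_{ba}=\{w\in V(G): d(b,w)<d(a,w)\}$. -}

module Defs where

open import Data.Nat using (ℕ; zero; suc; _<_; _≤_)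
open import Data.Bool using (Bool; true; false)
import Data.Bool as B
open import Data.Fin using (Fin)
open import Data.Vec using (Vec; lookup; replicate)
open import Data.List using (List; length)
open import Data.List.Membership.Propositional using (_∈_)
open import Data.List.Relation.Unary.Unique.Propositional using (Unique)
open import Data.Product using (Σ; ∃; ∃-syntax; _×_; _,_)
open import Relation.Binary.PropositionalEquality using (_≡_; _≢_)

Str : ℕ → Set
Str n = Vec Bool n

zeros : (n : ℕ) → Str n
zeros n = replicate n false

_≼_ : {n : ℕ} → Str n → Str n → Set
u ≼ v = ∀ i → lookup u i B.≤ lookup v i

Adj : {n : ℕ} → Str n → Str n → Set
Adj {n} u v = Σ (Fin n) λ i → (lookup u i ≢ lookup v i) × (∀ j → j ≢ i → lookup u j ≡ lookup v j)

-- vertex set of the daisy cube Q_n(X), X a finite set given as a list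
InDaisy : {n : ℕ} → List (Str n) → Str n → Set
InDaisy X u = ∃[ x ] (x ∈ X × u ≼ x)

data Walk {n : ℕ} (X : List (Str n)) : Str n → Str n → ℕ → Set where
  here : ∀ {u} → InDaisy X u → Walk X u u zero
  step : ∀ {u v w k} → InDaisy X u → Adj u v → Walk X v w k → Walk X u w (suc k)

Dist : {n : ℕ} → List (Str n) → Str n → Str n → ℕ → Set
Dist X u v k = Walk X u v k × (∀ j → Walk X u v j → k ≤ j)

InW : {n : ℕ} → List (Str n) → Str n → Str n → Str n → Set
InW X a b w = InDaisy X w × ∃[ k ] ∃[ l ] (Dist X a w k × Dist X b w l × k < l)

-- L is a duplicate-free enumeration of the set P (so |P| = length L)
Enumerates : {n : ℕ} → (Str n → Set) → List (Str n) → Set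
Enumerates P L = Unique L × (∀ w → w ∈ L → P w) × (∀ w → P w → w ∈ L)

Edge : {n : ℕ} → List (Str n) → Str n → Str n → Set
Edge X a b = InDaisy X a × InDaisy X b × Adj a b

-- G is downward closed under the componentwise order ≼, and this makes
-- it an isometric subgraph of Q_n: distances in G are Hamming distances
-- (a shortest walk can always first clear coordinates where the source has a
-- 1 and the target a 0, then set the remaining ones, never leaving G).
-- An edge ab flips a single coordinate i, i.e. b = toggle i a, so
-- W_ab = { w ∈ G : wᵢ = aᵢ }.  If aᵢ = 0 then 0ⁿ ∈ W_ab.  If aᵢ = 1, toggling
-- coordinate i injects W_ab into W_ba (it only clears a 1, so stays in G),
-- whence |W_ab| ≤ |W_ba|, contradicting the hypothesis.
module Submission where

open import Defs
open import Data.Nat using (ℕ; _<_)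
open import Data.List using (List; length)

open import Data.Nat using (zero; suc; _+_; _≤_; s≤s)
open import Data.Nat.Properties
  using (+-suc; suc-injective; ≤-antisym; ≤-trans; ≤-reflexive; n≤1+n; <-asym; <⇒≱)
open import Data.Bool using (Bool; true; false; not; b≤b; f≤t)
import Data.Bool as B
open import Data.Bool.Properties using (not-involutive; not-¬; ¬-not)
import Data.Bool.Properties as B
open import Data.Fin using (Fin)
import Data.Fin as Fin
open import Data.Fin.Properties using (any?; injective⇒≤)
open import Data.Vec using ([]; _∷_; lookup; _[_]%=_)
open import Data.Vec.Properties
  using (lookup∘updateAt; lookup∘updateAt′; updateAt-updateAt; updateAt-cong; updateAt-id;
         lookup-replicate)
open import Data.Vec.Relation.Binary.Pointwise.Extensional using (ext; Pointwise-≡⇒≡)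
import Data.List as List
open import Data.List.Membership.Propositional using (_∈_)
open import Data.List.Membership.Propositional.Properties using (∈-lookup)
open import Data.List.Membership.Setoid.Properties using (index-injective)
open import Data.List.Relation.Unary.Any using (index)
import Data.List.Relation.Unary.All as All
open import Data.List.Relation.Unary.AllPairs using (_∷_)
open import Data.List.Relation.Unary.Unique.Propositional using (Unique)
open import Data.Product using (∃-syntax; _×_; _,_; proj₁)
open import Data.Sum using (_⊎_; inj₁; inj₂)
open import Data.Empty using (⊥; ⊥-elim)
open import Function.Definitions using (Injective)
open import Relation.Nullary using (yes; no; contradiction)
open import Relation.Nullary.Decidable using (_×-dec_)
open import Relation.Binary.PropositionalEquality
open ≡-Reasoning

private
  variable
    n k : ℕ
    X : List (Str n)
    u v : Str n
    i : Fin n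

mismatch : Bool → Bool → ℕ
mismatch true  true  = 0
mismatch false false = 0
mismatch true  false = 1
mismatch false true  = 1

hamming : Str n → Str n → ℕ
hamming [] [] = 0
hamming (x ∷ u) (y ∷ v) = mismatch x y + hamming u v

hamming-self : (u : Str n) → hamming u u ≡ 0
hamming-self [] = refl
hamming-self (true ∷ u) = hamming-self u
hamming-self (false ∷ u) = hamming-self u

hamming-zero : (s t : Str n) → hamming s t ≡ 0 → s ≡ t
hamming-zero [] [] _ = refl
hamming-zero (true ∷ s) (true ∷ t) d = cong (true ∷_) (hamming-zero s t d)
hamming-zero (false ∷ s) (false ∷ t) d = cong (false ∷_) (hamming-zero s t d)

toggle : Fin n → Str n → Str n
toggle i u = u [ i ]%= not

toggle-involutive : (i : Fin n) (u : Str n) → toggle i (toggle i u) ≡ u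
toggle-involutive i u = begin
  toggle i (toggle i u)          ≡⟨ updateAt-updateAt i u ⟩
  u [ i ]%= (λ x → not (not x))  ≡⟨ updateAt-cong i not-involutive u ⟩
  u [ i ]%= (λ x → x)            ≡⟨ updateAt-id i u ⟩
  u                              ∎

toggle-injective : (i : Fin n) → Injective _≡_ _≡_ (toggle i)
toggle-injective i {u} {v} eq = begin
  u                      ≡⟨ sym (toggle-involutive i u) ⟩
  toggle i (toggle i u)  ≡⟨ cong (toggle i) eq ⟩
  toggle i (toggle i v)  ≡⟨ toggle-involutive i v ⟩
  v                      ∎

toggle-sym : v ≡ toggle i u → u ≡ toggle i v
toggle-sym {i = i} {u = u} refl = sym (toggle-involutive i u)

toggle-adj : (i : Fin n) (u : Str n) → Adj u (toggle i u)
toggle-adj i u =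
  i , (λ p → not-¬ refl (trans p (lookup∘updateAt i u))) ,
  (λ j j≢i → sym (lookup∘updateAt′ j i j≢i u))

adj⇒toggle : (adj : Adj u v) → v ≡ toggle (proj₁ adj) u
adj⇒toggle {u = u} {v = v} (i , uᵢ≢vᵢ , same) = Pointwise-≡⇒≡ (ext coordinate)
  where
  coordinate : ∀ j → lookup v j ≡ lookup (toggle i u) j
  coordinate j with j Fin.≟ i
  ... | yes refl = trans (¬-not (λ p → uᵢ≢vᵢ (sym p))) (sym (lookup∘updateAt i u))
  ... | no j≢i = trans (sym (same j j≢i)) (sym (lookup∘updateAt′ j i j≢i u))

hamming-toggle-agree : (i : Fin n) (u w : Str n) → lookup w i ≡ lookup u i →
  hamming (toggle i u) w ≡ suc (hamming u w)
hamming-toggle-agree Fin.zero (true ∷ _) (.true ∷ _) refl = refl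
hamming-toggle-agree Fin.zero (false ∷ _) (.false ∷ _) refl = refl
hamming-toggle-agree (Fin.suc i) (x ∷ u) (y ∷ w) agree = begin
  mismatch x y + hamming (toggle i u) w  ≡⟨ cong (mismatch x y +_) (hamming-toggle-agree i u w agree) ⟩
  mismatch x y + suc (hamming u w)       ≡⟨ +-suc (mismatch x y) (hamming u w) ⟩
  suc (mismatch x y + hamming u w)       ∎

hamming-toggle-disagree : (i : Fin n) (u w : Str n) → lookup w i ≢ lookup u i →
  hamming u w ≡ suc (hamming (toggle i u) w)
hamming-toggle-disagree i u w disagree = begin
  hamming u w                          ≡⟨ cong (λ x → hamming x w) (sym (toggle-involutive i u)) ⟩
  hamming (toggle i (toggle i u)) w    ≡⟨ hamming-toggle-agree i (toggle i u) w wᵢ≡ ⟩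
  suc (hamming (toggle i u) w)         ∎
  where
  wᵢ≡ : lookup w i ≡ lookup (toggle i u) i
  wᵢ≡ = trans (¬-not disagree) (sym (lookup∘updateAt i u))

adj-hamming-≤ : (u v : Str n) → Adj u v → (w : Str n) → hamming u w ≤ suc (hamming v w)
adj-hamming-≤ u v adj@(i , _) w with refl ← adj⇒toggle {u = u} {v = v} adj | lookup w i B.≟ lookup u i
... | yes agree = ≤-trans (n≤1+n (hamming u w))
                    (≤-trans (≤-reflexive (sym (hamming-toggle-agree i u w agree))) (n≤1+n _))
... | no disagree = ≤-reflexive (hamming-toggle-disagree i u w disagree)

daisy-down : (u v : Str n) → u ≼ v → InDaisy X v → InDaisy X u
daisy-down u v u≼v (x , x∈X , v≼x) = x , x∈X , λ j → B.≤-trans (u≼v j) (v≼x j)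

zeros-daisy : (u : Str n) → InDaisy X u → InDaisy X (zeros n)
zeros-daisy {n = n} u = daisy-down (zeros n) u λ j →
  subst (B._≤ lookup u j) (sym (lookup-replicate j false)) (B.≤-minimum _)

toggle-≼ : (i : Fin n) (s t : Str n) → (∀ j → j ≢ i → lookup s j B.≤ lookup t j) →
  not (lookup s i) B.≤ lookup t i → toggle i s ≼ t
toggle-≼ i s t off at j with j Fin.≟ i
... | yes refl = subst (B._≤ lookup t i) (sym (lookup∘updateAt i s)) at
... | no j≢i = subst (B._≤ lookup t j) (sym (lookup∘updateAt′ j i j≢i s)) (off j j≢i)

toggle-true-≼ : (i : Fin n) (s : Str n) → lookup s i ≡ true → toggle i s ≼ s
toggle-true-≼ i s sᵢ =
  toggle-≼ i s s (λ _ _ → B.≤-refl) (subst (B._≤ lookup s i) (cong not (sym sᵢ)) (B.≤-minimum _))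

descent-coordinate : (s t : Str n) → (∃[ i ] (lookup s i ≡ true × lookup t i ≡ false)) ⊎ s ≼ t
descent-coordinate s t with any? (λ i → (lookup s i B.≟ true) ×-dec (lookup t i B.≟ false))
... | yes found = inj₁ found
... | no none = inj₂ (λ i → bool-≤ (λ sᵢ tᵢ → none (i , sᵢ , tᵢ)))
  where
  bool-≤ : ∀ {x y} → (x ≡ true → y ≡ false → ⊥) → x B.≤ y
  bool-≤ {false} _ = B.≤-minimum _
  bool-≤ {true} {true} _ = b≤b
  bool-≤ {true} {false} impossible = ⊥-elim (impossible refl refl)

ascent-coordinate : (s t : Str n) → s ≼ t → (∃[ i ] (lookup s i ≡ false × lookup t i ≡ true)) ⊎ s ≡ t
ascent-coordinate s t s≼t with any? (λ i → (lookup s i B.≟ false) ×-dec (lookup t i B.≟ true))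
... | yes found = inj₁ found
... | no none = inj₂ (Pointwise-≡⇒≡ (ext λ i → bool-≤-≡ (s≼t i) (λ sᵢ tᵢ → none (i , sᵢ , tᵢ))))
  where
  bool-≤-≡ : ∀ {x y} → x B.≤ y → (x ≡ false → y ≡ true → ⊥) → x ≡ y
  bool-≤-≡ b≤b _ = refl
  bool-≤-≡ f≤t impossible = ⊥-elim (impossible refl refl)

toggle-closer : ∀ {x} (i : Fin n) (s t : Str n) → lookup s i ≡ x → lookup t i ≡ not x →
  hamming s t ≡ suc k → hamming (toggle i s) t ≡ k
toggle-closer i s t sᵢ tᵢ d =
  suc-injective (trans (sym (hamming-toggle-disagree i s t (λ p → not-¬ sᵢ (trans (sym p) tᵢ)))) d)

-- From a daisy vertex s ≠ t there is a neighbour in the daisy cube one step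
-- closer to t: clear a 1 of s that t lacks, or else set a 1 of t that s lacks.
step-closer : (s t : Str n) → InDaisy X s → InDaisy X t → hamming s t ≡ suc k →
  ∃[ s′ ] (InDaisy X s′ × Adj s s′ × hamming s′ t ≡ k)
step-closer s t s∈ t∈ d with descent-coordinate s t
... | inj₁ (i , sᵢ , tᵢ) =
  toggle i s , daisy-down (toggle i s) s (toggle-true-≼ i s sᵢ) s∈ ,
  toggle-adj i s , toggle-closer i s t sᵢ tᵢ d
... | inj₂ s≼t with ascent-coordinate s t s≼t
...   | inj₁ (i , sᵢ , tᵢ) =
  toggle i s ,
  daisy-down (toggle i s) t (toggle-≼ i s t (λ j _ → s≼t j) (B.≤-reflexive (trans (cong not sᵢ) (sym tᵢ)))) t∈ ,
  toggle-adj i s , toggle-closer i s t sᵢ tᵢ d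
...   | inj₂ refl with () ← trans (sym d) (hamming-self s)

geodesic : (k : ℕ) (s t : Str n) → InDaisy X s → InDaisy X t → hamming s t ≡ k → Walk X s t k
geodesic zero s t s∈ t∈ d with refl ← hamming-zero s t d = here s∈
geodesic (suc k) s t s∈ t∈ d with step-closer s t s∈ t∈ d
... | s′ , s′∈ , adj , d′ = step s∈ adj (geodesic k s′ t s′∈ t∈ d′)

walk-bound : Walk X u v k → hamming u v ≤ k
walk-bound (here {u} _) = ≤-reflexive (hamming-self u)
walk-bound {v = v} (step {u} {u′} _ adj walk) = ≤-trans (adj-hamming-≤ u u′ adj v) (s≤s (walk-bound walk))

hamming-distance : (u v : Str n) → InDaisy X u → InDaisy X v → Dist X u v (hamming u v)
hamming-distance u v u∈ v∈ = geodesic (hamming u v) u v u∈ v∈ refl , λ _ walk → walk-bound walk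

distance-is-hamming : (u v : Str n) → InDaisy X u → InDaisy X v → Dist X u v k → k ≡ hamming u v
distance-is-hamming u v u∈ v∈ (walk , shortest) =
  ≤-antisym (shortest _ (geodesic (hamming u v) u v u∈ v∈ refl)) (walk-bound walk)

agree⇒W : (i : Fin n) (u v w : Str n) → v ≡ toggle i u →
  InDaisy X u → InDaisy X v → InDaisy X w → lookup w i ≡ lookup u i → InW X u v w
agree⇒W i u v w refl u∈ v∈ w∈ agree =
  w∈ , hamming u w , hamming v w , hamming-distance u w u∈ w∈ , hamming-distance v w v∈ w∈ ,
  ≤-reflexive (sym (hamming-toggle-agree i u w agree))

W⇒agree : (i : Fin n) (u v w : Str n) → v ≡ toggle i u →
  InDaisy X u → InDaisy X v → InW X u v w → lookup w i ≡ lookup u i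
W⇒agree i u v w refl u∈ v∈ (w∈ , k , l , du , dv , k<l)
  with refl ← distance-is-hamming u w u∈ w∈ du | refl ← distance-is-hamming v w v∈ w∈ dv
     | lookup w i B.≟ lookup u i
... | yes agree = agree
... | no disagree = contradiction (≤-reflexive (sym (hamming-toggle-disagree i u w disagree))) (<-asym k<l)

-- When aᵢ = 1, toggling coordinate i maps W_ab into W_ba: it clears the i-th
-- bit (so stays in G) and makes the vertex agree with b there.
toggle-W : (i : Fin n) (a b w : Str n) → b ≡ toggle i a → InDaisy X a → InDaisy X b →
  lookup a i ≡ true → InW X a b w → InW X b a (toggle i w)
toggle-W i a b w b≡ a∈ b∈ aᵢ w∈W =
  agree⇒W i b a (toggle i w) (toggle-sym b≡) b∈ a∈ w′∈ agree
  where
  wᵢ≡aᵢ : lookup w i ≡ lookup a i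
  wᵢ≡aᵢ = W⇒agree i a b w b≡ a∈ b∈ w∈W
  w′∈ : InDaisy _ (toggle i w)
  w′∈ = daisy-down (toggle i w) w (toggle-true-≼ i w (trans wᵢ≡aᵢ aᵢ)) (proj₁ w∈W)
  agree : lookup (toggle i w) i ≡ lookup b i
  agree = begin
    lookup (toggle i w) i  ≡⟨ lookup∘updateAt i w ⟩
    not (lookup w i)       ≡⟨ cong not wᵢ≡aᵢ ⟩
    not (lookup a i)       ≡⟨ sym (lookup∘updateAt i a) ⟩
    lookup (toggle i a) i  ≡⟨ cong (λ x → lookup x i) (sym b≡) ⟩
    lookup b i             ∎

unique-lookup-injective : {A : Set} {xs : List A} → Unique xs →
  ∀ {k l} → List.lookup xs k ≡ List.lookup xs l → k ≡ l
unique-lookup-injective (_ ∷ _) {Fin.zero} {Fin.zero} _ = refl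
unique-lookup-injective (x∉xs ∷ _) {Fin.zero} {Fin.suc l} eq = ⊥-elim (All.lookup x∉xs (∈-lookup l) eq)
unique-lookup-injective (x∉xs ∷ _) {Fin.suc k} {Fin.zero} eq = ⊥-elim (All.lookup x∉xs (∈-lookup k) (sym eq))
unique-lookup-injective (_ ∷ u) {Fin.suc k} {Fin.suc l} eq = cong Fin.suc (unique-lookup-injective u eq)

unique-injection-≤ : {A : Set} {g : A → A} {xs ys : List A} → Unique xs → Injective _≡_ _≡_ g →
  (∀ x → x ∈ xs → g x ∈ ys) → length xs ≤ length ys
unique-injection-≤ {A = A} {xs = xs} {ys} xs-unique g-injective into = injective⇒≤ position-injective
  where
  position : Fin (length xs) → Fin (length ys)
  position k = index (into _ (∈-lookup k))
  position-injective : Injective _≡_ _≡_ position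
  position-injective {k} {l} eq = unique-lookup-injective xs-unique
    (g-injective (index-injective (setoid A) (into _ (∈-lookup k)) (into _ (∈-lookup l)) eq))

W-count : (i : Fin n) (a b : Str n) (LA LB : List (Str n)) → b ≡ toggle i a →
  InDaisy X a → InDaisy X b → lookup a i ≡ true →
  Enumerates (InW X a b) LA → Enumerates (InW X b a) LB → length LA ≤ length LB
W-count i a b LA LB b≡ a∈ b∈ aᵢ (LA-unique , LA⊆W , _) (_ , _ , W⊆LB) =
  unique-injection-≤ LA-unique (toggle-injective i)
    (λ w w∈LA → W⊆LB (toggle i w) (toggle-W i a b w b≡ a∈ b∈ aᵢ (LA⊆W w w∈LA)))

proposition3p1 : (n : ℕ) (X : List (Str n)) (a b : Str n) → Edge X a b →
    (LA LB : List (Str n)) → Enumerates (InW X a b) LA → Enumerates (InW X b a) LB →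
    length LB < length LA → InW X a b (zeros n)
proposition3p1 n X a b (a∈G , b∈G , adj@(i , _)) LA LB enumA enumB |LB|<|LA|
  with lookup a i B.≟ false
... | yes aᵢ = agree⇒W i a b (zeros n) (adj⇒toggle adj) a∈G b∈G (zeros-daisy a a∈G)
                (trans (lookup-replicate i false) (sym aᵢ))
... | no aᵢ≢0 = contradiction (W-count i a b LA LB (adj⇒toggle adj) a∈G b∈G (¬-not aᵢ≢0) enumA enumB)
               (<⇒≱ |LB|<|LA|)
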